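{- (1) Let $j\ge 2$. Then the sequence $\{F_j^{(r)}\}_{r=1}^{\infty}$ is strictly increasing. (2) Let $r\ge 2$. Then the sequence $\{F_j^{(r)}\}_{j=1}^{\infty}$ is strictly increasing.
   Context: For a positive integer $r$, the convolved Fibonacci numbers $F_{j+1}^{(r)}$ ($j\ge0$) are defined by $(1-z-z^2)^{ -r}=\sum_{j\ge 0}F_{j+1}^{(r)}z^j$. -}

module Defs where

open import Data.Nat using (ℕ; zero; suc; _+_)

-- coeff r j = [z^j] (1 - z - z^2)^(-r), for r ≥ 0.
-- Defined by (1 - z - z^2) · S_r(z) = S_{r-1}(z), S_0 = 1, i.e. coefficientwise
--   coeff r j = coeff (r-1) j + coeff r (j-1) + coeff r (j-2)  (terms with negative index are 0).
coeff : ℕ → ℕ → ℕ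
coeff zero zero = 1
coeff zero (suc j) = 0
coeff (suc r) zero = coeff r zero
coeff (suc r) (suc zero) = coeff r 1 + coeff (suc r) zero
coeff (suc r) (suc (suc j)) = coeff r (suc (suc j)) + coeff (suc r) (suc j) + coeff (suc r) j

-- Convolved Fibonacci number F_j^{(r)} (j ≥ 1): F_{j+1}^{(r)} = coeff r j.
-- F_0^{(r)} is not defined in the paper; we set it to 0 (never used below).
F : ℕ → ℕ → ℕ
F zero r = 0
F (suc j) r = coeff r j

{-# OPTIONS --safe #-}
module Submission where

-- Both monotonicities come from the recurrence
--   coeff (r+1) (j+1) ≥ coeff r (j+1) + coeff (r+1) j,
-- obtained by dropping the nonnegative term coeff (r+1) (j-1): the right side
-- exceeds the first summand when coeff (r+1) j > 0 (increase in r), and the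
-- second summand when coeff r (j+1) > 0 (increase in j). Positivity of
-- coeff (r+1) j, for every j, follows from the same bound and coeff r 0 = 1.
-- The increase in r needs no positivity of coeff r.

open import Defs
open import Data.Nat using (ℕ; suc; zero; _<_; _≤_; _+_; s≤s)
open import Data.Nat.Properties using (≤-trans; <-≤-trans; ≤-reflexive; m≤m+n; m≤n+m; m<m+n; m<n+m)
open import Data.Product using (_×_; _,_)
open import Relation.Binary.PropositionalEquality using (_≡_; refl; sym)

coeff-zero : ∀ r → coeff r 0 ≡ 1
coeff-zero zero    = refl
coeff-zero (suc r) = coeff-zero r

coeff-suc-suc-≥ : ∀ r j → coeff r (suc j) + coeff (suc r) j ≤ coeff (suc r) (suc j)
coeff-suc-suc-≥ r zero    = ≤-reflexive refl
coeff-suc-suc-≥ r (suc j) = m≤m+n _ (coeff (suc r) j)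

coeff-suc-positive : ∀ r j → 0 < coeff (suc r) j
coeff-suc-positive r zero    = ≤-reflexive (sym (coeff-zero r))
coeff-suc-positive r (suc j) =
  ≤-trans (coeff-suc-positive r j)
          (≤-trans (m≤n+m _ (coeff r (suc j))) (coeff-suc-suc-≥ r j))

coeff-<-suc-order : ∀ r j → coeff r (suc j) < coeff (suc r) (suc j)
coeff-<-suc-order r j =
  <-≤-trans (m<m+n _ (coeff-suc-positive r j)) (coeff-suc-suc-≥ r j)

coeff-<-suc-index : ∀ r j → coeff (suc (suc r)) j < coeff (suc (suc r)) (suc j)
coeff-<-suc-index r j =
  <-≤-trans (m<n+m _ (coeff-suc-positive r (suc j))) (coeff-suc-suc-≥ (suc r) j)

mainTheorem7 : ((j : ℕ) → 2 ≤ j → (r : ℕ) → 1 ≤ r → F j r < F j (suc r))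
    × ((r : ℕ) → 2 ≤ r → (j : ℕ) → 1 ≤ j → F j r < F (suc j) r)
mainTheorem7 = increasing-in-r , increasing-in-j
  where
  increasing-in-r : (j : ℕ) → 2 ≤ j → (r : ℕ) → 1 ≤ r → F j r < F j (suc r)
  increasing-in-r (suc zero)    (s≤s ()) _ _
  increasing-in-r (suc (suc j)) _ r _ = coeff-<-suc-order r j

  increasing-in-j : (r : ℕ) → 2 ≤ r → (j : ℕ) → 1 ≤ j → F j r < F (suc j) r
  increasing-in-j (suc zero)    (s≤s ()) _ _
  increasing-in-j (suc (suc r)) _ (suc j) _ = coeff-<-suc-index r j
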